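{- Let $G$ be a finite nilpotent group. Then the power graph $\mathcal{P}(G)$ is the line graph of some graph $\Gamma$ if and only if $G$ is a cyclic $p$-group (for some prime $p$).
   Context: For a finite group $G$, the power graph $\mathcal{P}(G)$ is the simple graph with vertex set $G$ in which two distinct vertices $u,v$ are adjacent if and only if $u^m=v$ or $v^n=u$ for some positive integers $m,n$. The line graph $L(\Gamma)$ of a graph $\Gamma$ has the edges of $\Gamma$ as vertices, two being adjacent iff they share an endpoint in $\Gamma$. -}

module Defs where

open import Level using (0ℓ)
open import Data.Nat using (ℕ; zero; suc; _^_)
open import Data.Nat.Primality using (Prime)
open import Data.Fin using (Fin)
open import Data.Product using (Σ; ∃; ∃-syntax; _×_; _,_; proj₁; proj₂)
open import Data.Sum using (_⊎_)
open import Relation.Binary.PropositionalEquality using (_≡_; _≢_)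
open import Relation.Nullary using (¬_)
open import Algebra.Structures using (IsGroup)
open import Function.Bundles using (_⇔_)

record FinGroup (n : ℕ) : Set where
  infixl 7 _∙_
  field
    _∙_     : Fin n → Fin n → Fin n
    ε       : Fin n
    _⁻¹     : Fin n → Fin n
    isGroup : IsGroup _≡_ _∙_ ε _⁻¹

module _ {n : ℕ} (G : FinGroup n) where
  open FinGroup G

  pow : Fin n → ℕ → Fin n
  pow g zero    = ε
  pow g (suc m) = g ∙ pow g m

  comm : Fin n → Fin n → Fin n
  comm g x = g ∙ x ∙ (g ⁻¹) ∙ (x ⁻¹)

  -- membership in the i-th term Z_i of the upper central series:
  -- Z_0 = {ε},  g ∈ Z_{i+1}  iff  [g , x] ∈ Z_i for all x.
  InUpperCentral : ℕ → Fin n → Set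
  InUpperCentral zero    g = g ≡ ε
  InUpperCentral (suc i) g = ∀ x → InUpperCentral i (comm g x)

  IsNilpotent : Set
  IsNilpotent = ∃[ c ] (∀ g → InUpperCentral c g)

  IsCyclic : Set
  IsCyclic = ∃[ g ] (∀ h → ∃[ m ] (pow g m ≡ h))

  IsCyclicPGroup : Set
  IsCyclicPGroup = IsCyclic × ∃[ p ] (Prime p × ∃[ k ] (n ≡ p ^ k))

  PowerAdj : Fin n → Fin n → Set
  PowerAdj u v = u ≢ v × ((∃[ m ] (pow u (suc m) ≡ v)) ⊎ (∃[ m ] (pow v (suc m) ≡ u)))

record SimpleGraph : Set₁ where
  field
    V       : Set
    Adj     : V → V → Set
    sym     : ∀ {a b} → Adj a b → Adj b a
    irrefl  : ∀ {a} → ¬ Adj a a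

-- An edge of Γ is represented by an ordered pair of its endpoints;
-- two such pairs denote the same (unordered) edge iff they agree up to swap.
SameEdge : {V : Set} → V × V → V × V → Set
SameEdge (a , b) (c , d) = (a ≡ c × b ≡ d) ⊎ (a ≡ d × b ≡ c)

ShareEndpoint : {V : Set} → V × V → V × V → Set
ShareEndpoint (a , b) (c , d) = (a ≡ c ⊎ a ≡ d) ⊎ (b ≡ c ⊎ b ≡ d)

-- An isomorphism between the graph (Fin n, A) and the line graph L(Γ):
-- a bijection x ↦ ends x from Fin n onto the edge set of Γ
-- such that x, y are adjacent iff they are distinct and the edges share an endpoint.
record LineGraphIso {n : ℕ} (A : Fin n → Fin n → Set) (Γ : SimpleGraph) : Set where
  open SimpleGraph Γ
  field
    ends    : Fin n → V × V
    isEdge  : ∀ x → Adj (proj₁ (ends x)) (proj₂ (ends x))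
    onto    : ∀ a b → Adj a b → ∃[ x ] SameEdge (ends x) (a , b)
    inj     : ∀ x y → SameEdge (ends x) (ends y) → x ≡ y
    adjIff  : ∀ x y → A x y ⇔ (x ≢ y × ShareEndpoint (ends x) (ends y))

IsLineGraph : {n : ℕ} → (Fin n → Fin n → Set) → Set₁
IsLineGraph A = ∃[ Γ ] LineGraphIso A Γ

-- Line graphs contain neither a claw K₁,₃ nor K₅ minus an edge: a common neighbour of two
-- disjoint edges joins an end of one to an end of the other, and these joining edges form a
-- triangle-free 4-cycle.
-- Write h ≼ x when h is a power of x. If a, b, c are maximal for ≼ with b ⋠ a and a b ≼ c,
-- then a, b, c are pairwise incomparable, so together with the identity they form a claw in
-- P(G). Hence if P(G) is a line graph, a maximal element generates G. If moreover |G| = r s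
-- with coprime r, s ≥ 2, then g^r and g^s are non-adjacent while ε, g and g⁻¹ are adjacent to
-- all other vertices: a K₅ minus an edge. Conversely, the subgroups of a cyclic p-group form a
-- chain, so its power graph is complete, and Kₙ is the line graph of the star K₁,ₙ.

module Submission where

open import Defs
open import Level using (0ℓ)
open import Algebra.Bundles using (Group)
open import Algebra.Structures using (IsGroup)
import Algebra.Properties.Group as GroupProperties
open import Data.Bool using (Bool; true; false; not; _xor_; if_then_else_)
open import Data.Bool.Properties using (not-injective; not-involutive; ¬-not)
open import Data.Empty using (⊥; ⊥-elim)
open import Data.Fin using (Fin; toℕ; fromℕ<) renaming (_≟_ to _≟ᶠ_)
open import Data.Fin.Induction using (spo-noetherian)
open import Data.Fin.Properties
  using (injective⇒≤; nonZeroIndex; toℕ-fromℕ<; toℕ≤pred[n]; pigeonhole; any?; all?; ¬∀⟶∃¬)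
open import Data.List using ([]; _∷_)
open import Data.List.Relation.Unary.All using (_∷_)
open import Data.Maybe using (Maybe; nothing; just)
open import Data.Nat
  using (ℕ; zero; suc; _+_; _*_; _^_; _∸_; _≤_; _<_; _%_; _/_; NonZero; z≤n; s≤s; z<s; 2+;
         >-nonZero; >-nonZero⁻¹; nonTrivial⇒n>1)
open import Data.Nat.Coprimality using (Coprime; coprime-divisor) renaming (sym to coprime-sym)
open import Data.Nat.Divisibility
  using (_∣_; divides; _∣?_; _∣0; ∣1⇒≡1; *-cancelʳ-∣; m∣m*n; n∣m*n; ∣-trans; ∣-refl; m%n≡0⇒n∣m)
open import Data.Nat.DivMod using (m≡m%n+[m/n]*n; m%n<n; m∣n⇒o%n%m≡o%m; m*n%n≡0)
open import Data.Nat.GCD using (gcd; gcd-GCD; gcd[m,n]∣m; gcd[m,n]∣n; module Bézout)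
open import Data.Nat.Induction using (<-wellFounded)
open import Data.Nat.Primality
  using (Prime; prime⇒irreducible; prime⇒nonZero; prime⇒nonTrivial; prime[2])
open import Data.Nat.Primality.Factorisation using (factorise)
open import Data.Nat.Properties
  using (≤-trans; ≤-reflexive; ≤-antisym; ≤-total; <-trans; <-≤-trans; <⇒≢; <⇒≱; <-cmp;
         n≤1+n; n<1+n; m≤n+m; m+[n∸m]≡n; +-suc; *-comm; *-identityˡ; *-identityʳ; *-mono-≤;
         ^-distribˡ-+-*; m^n>0; m<m*n)
open import Data.Nat.Tactic.RingSolver using (solve-∀)
open import Data.Product using (Σ-syntax; ∃-syntax; ∃₂; _×_; _,_; proj₁; proj₂)
open import Data.Sum using (_⊎_; inj₁; inj₂; [_,_])
import Data.Sum as Sum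
open import Data.Unit using (⊤)
open import Function using (_∘_; flip; case_of_)
open import Function.Bundles using (_⇔_; mk⇔; Equivalence)
open import Induction.WellFounded using (Acc; acc)
open import Relation.Binary.Definitions using (tri<; tri≈; tri>)
open import Relation.Binary.PropositionalEquality
  using (_≡_; _≢_; refl; sym; trans; cong; cong₂; subst; isEquivalence; module ≡-Reasoning)
open import Relation.Binary.Structures using (IsStrictPartialOrder)
open import Relation.Nullary using (¬_; Dec; yes; no)
open import Relation.Nullary.Decidable using (map′; decidable-stable; _×-dec_; ¬?)

-- Line graphs

module _ {V : Set} where

  infix 4 _∈ₑ_

  _∈ₑ_ : V → V × V → Set
  q ∈ₑ (a , b) = q ≡ a ⊎ q ≡ b

  -- ShareEndpoint (a , b) f unfolds to a ∈ₑ f ⊎ b ∈ₑ f.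
  common⇒share : ∀ {q} {e f : V × V} → q ∈ₑ e → q ∈ₑ f → ShareEndpoint e f
  common⇒share (inj₁ refl) q∈f = inj₁ q∈f
  common⇒share (inj₂ refl) q∈f = inj₂ q∈f

  share⇒common : ∀ {e f : V × V} → ShareEndpoint e f → ∃[ q ] (q ∈ₑ e × q ∈ₑ f)
  share⇒common (inj₁ a∈f) = _ , inj₁ refl , a∈f
  share⇒common (inj₂ b∈f) = _ , inj₂ refl , b∈f

  sameEdge-sym : ∀ {e f : V × V} → SameEdge e f → SameEdge f e
  sameEdge-sym (inj₁ (refl , refl)) = inj₁ (refl , refl)
  sameEdge-sym (inj₂ (refl , refl)) = inj₂ (refl , refl)

  sameEdge-trans : ∀ {e f g : V × V} → SameEdge e f → SameEdge f g → SameEdge e g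
  sameEdge-trans (inj₁ (refl , refl)) f~g = f~g
  sameEdge-trans (inj₂ (refl , refl)) (inj₁ (refl , refl)) = inj₂ (refl , refl)
  sameEdge-trans (inj₂ (refl , refl)) (inj₂ (refl , refl)) = inj₁ (refl , refl)

  sameEdge-∈ₑ : ∀ {q} {e f : V × V} → SameEdge e f → q ∈ₑ e → q ∈ₑ f
  sameEdge-∈ₑ (inj₁ (refl , refl)) q∈e = q∈e
  sameEdge-∈ₑ (inj₂ (refl , refl)) (inj₁ q≡a) = inj₂ q≡a
  sameEdge-∈ₑ (inj₂ (refl , refl)) (inj₂ q≡b) = inj₁ q≡b

  sameEdge-share : ∀ {e e′ f f′ : V × V} → SameEdge e e′ → SameEdge f f′ →
                   ShareEndpoint e f → ShareEndpoint e′ f′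
  sameEdge-share e~e′ f~f′ sh =
    let q , q∈e , q∈f = share⇒common sh
    in common⇒share (sameEdge-∈ₑ e~e′ q∈e) (sameEdge-∈ₑ f~f′ q∈f)

  if-∈ₑ : ∀ i {a b : V} → (if i then a else b) ∈ₑ (a , b)
  if-∈ₑ true  = inj₁ refl
  if-∈ₑ false = inj₂ refl

  ∈ₑ⇒if : ∀ {q a b : V} → q ∈ₑ (a , b) → ∃[ i ] (q ≡ (if i then a else b))
  ∈ₑ⇒if (inj₁ q≡a) = true , q≡a
  ∈ₑ⇒if (inj₂ q≡b) = false , q≡b

  if-not-≢ : ∀ i {a b : V} → a ≢ b → (if i then a else b) ≢ (if not i then a else b)
  if-not-≢ true  a≢b = a≢b
  if-not-≢ false a≢b = a≢b ∘ sym

xor-≡⇒same⊎opposite : ∀ i₁ j₁ i₂ j₂ → i₁ xor j₁ ≡ i₂ xor j₂ →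
                      (i₁ ≡ i₂ × j₁ ≡ j₂) ⊎ (i₂ ≡ not i₁ × j₂ ≡ not j₁)
xor-≡⇒same⊎opposite true  j₁ true  j₂ e = inj₁ (refl , not-injective e)
xor-≡⇒same⊎opposite false j₁ false j₂ e = inj₁ (refl , e)
xor-≡⇒same⊎opposite true  j₁ false j₂ e = inj₂ (refl , sym e)
xor-≡⇒same⊎opposite false j₁ true  j₂ e = inj₂ (refl , sym (trans (cong not e) (not-involutive j₂)))

¬three-distinct : ∀ (a b c : Bool) → a ≢ b → b ≢ c → a ≢ c → ⊥
¬three-distinct a b c a≢b b≢c a≢c =
  a≢c (trans (¬-not a≢b) (trans (cong not (¬-not b≢c)) (not-involutive c)))

module _ {m : ℕ} (A : Fin m → Fin m → Set) where

  record Claw : Set where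
    field
      centre a b c    : Fin m
      adj-a           : A centre a
      adj-b           : A centre b
      adj-c           : A centre c
      a≢b             : a ≢ b
      b≢c             : b ≢ c
      a≢c             : a ≢ c
      ¬ab             : ¬ A a b
      ¬bc             : ¬ A b c
      ¬ac             : ¬ A a c

  record K₅MinusEdge : Set where
    field
      x y c d e       : Fin m
      x≢y             : x ≢ y
      ¬xy             : ¬ A x y
      cx              : A c x
      cy              : A c y
      dx              : A d x
      dy              : A d y
      ex              : A e x
      ey              : A e y
      cd              : A c d
      de              : A d e
      ce              : A c e

module LineGraph {m : ℕ} {A : Fin m → Fin m → Set} {Γ : SimpleGraph} (L : LineGraphIso A Γ) where
  open SimpleGraph Γ using (V; Adj; irrefl)
  open LineGraphIso L

  adj⇒share : ∀ {x y} → A x y → ShareEndpoint (ends x) (ends y)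
  adj⇒share {x} {y} a = proj₂ (Equivalence.to (adjIff x y) a)

  adj⇒≢ : ∀ {x y} → A x y → x ≢ y
  adj⇒≢ {x} {y} a = proj₁ (Equivalence.to (adjIff x y) a)

  ¬adj⇒disjoint : ∀ {x y} → x ≢ y → ¬ A x y → ¬ ShareEndpoint (ends x) (ends y)
  ¬adj⇒disjoint {x} {y} x≢y ¬a sh = ¬a (Equivalence.from (adjIff x y) (x≢y , sh))

  ends-≢ : ∀ x → proj₁ (ends x) ≢ proj₂ (ends x)
  ends-≢ x e = irrefl (subst (Adj (proj₁ (ends x))) (sym e) (isEdge x))

  neighbours-share : ∀ {z a b c} → A z a → A z b → A z c →
                     ShareEndpoint (ends a) (ends b) ⊎ ShareEndpoint (ends b) (ends c)
                     ⊎ ShareEndpoint (ends a) (ends c)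
  neighbours-share za zb zc with adj⇒share za | adj⇒share zb | adj⇒share zc
  ... | inj₁ p | inj₁ q | _      = inj₁ (common⇒share p q)
  ... | inj₂ p | inj₂ q | _      = inj₁ (common⇒share p q)
  ... | _      | inj₁ p | inj₁ q = inj₂ (inj₁ (common⇒share p q))
  ... | _      | inj₂ p | inj₂ q = inj₂ (inj₁ (common⇒share p q))
  ... | inj₁ p | inj₂ _ | inj₁ q = inj₂ (inj₂ (common⇒share p q))
  ... | inj₂ p | inj₁ _ | inj₂ q = inj₂ (inj₂ (common⇒share p q))

  claw-free : ¬ Claw A
  claw-free claw =
    [ ¬adj⇒disjoint a≢b ¬ab , [ ¬adj⇒disjoint b≢c ¬bc , ¬adj⇒disjoint a≢c ¬ac ] ]
      (neighbours-share adj-a adj-b adj-c)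
    where open Claw claw

  module CommonNeighbours {x y : Fin m} (x≢y : x ≢ y) (¬xy : ¬ A x y) where
    private
      u = proj₁ (ends x)
      v = proj₂ (ends x)
      w = proj₁ (ends y)
      z = proj₂ (ends y)

      x-end y-end : Bool → V
      x-end i = if i then u else v
      y-end j = if j then w else z

      disjoint : ¬ ShareEndpoint (ends x) (ends y)
      disjoint = ¬adj⇒disjoint x≢y ¬xy

      cross : ∀ i j → x-end i ≢ y-end j
      cross i j e = disjoint (common⇒share (if-∈ₑ i) (subst (_∈ₑ ends y) (sym e) (if-∈ₑ j)))

    -- i xor j properly 2-colours the 4-cycle of edges joining an end of x to an end of y.
    Joining : Fin m → Set
    Joining c = Σ[ i ∈ Bool ] Σ[ j ∈ Bool ] SameEdge (ends c) (x-end i , y-end j)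

    parity : ∀ {c} → Joining c → Bool
    parity (i , j , _) = i xor j

    joining : ∀ {c} → A c x → A c y → Joining c
    joining cx cy with adj⇒share cx | adj⇒share cy
    ... | inj₁ p | inj₁ q = ⊥-elim (disjoint (common⇒share p q))
    ... | inj₂ p | inj₂ q = ⊥-elim (disjoint (common⇒share p q))
    ... | inj₁ p | inj₂ q = let i , eᵢ = ∈ₑ⇒if p ; j , eⱼ = ∈ₑ⇒if q in i , j , inj₁ (eᵢ , eⱼ)
    ... | inj₂ p | inj₁ q = let i , eᵢ = ∈ₑ⇒if p ; j , eⱼ = ∈ₑ⇒if q in i , j , inj₂ (eⱼ , eᵢ)

    opposite-disjoint : ∀ i j → ¬ ShareEndpoint (x-end i , y-end j) (x-end (not i) , y-end (not j))
    opposite-disjoint i j (inj₁ (inj₁ e)) = if-not-≢ i (ends-≢ x) e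
    opposite-disjoint i j (inj₁ (inj₂ e)) = cross i (not j) e
    opposite-disjoint i j (inj₂ (inj₁ e)) = cross (not i) j (sym e)
    opposite-disjoint i j (inj₂ (inj₂ e)) = if-not-≢ j (ends-≢ y) e

    adj⇒parity-≢ : ∀ {c d} → A c d → (jc : Joining c) (jd : Joining d) → parity jc ≢ parity jd
    adj⇒parity-≢ cd (i , j , c~) (i′ , j′ , d~) e with xor-≡⇒same⊎opposite i j i′ j′ e
    ... | inj₁ (refl , refl) = adj⇒≢ cd (inj _ _ (sameEdge-trans c~ (sameEdge-sym d~)))
    ... | inj₂ (refl , refl) = opposite-disjoint i j (sameEdge-share c~ d~ (adj⇒share cd))

  K₅MinusEdge-free : ¬ K₅MinusEdge A
  K₅MinusEdge-free k =
    ¬three-distinct _ _ _ (adj⇒parity-≢ cd jc jd) (adj⇒parity-≢ de jd je) (adj⇒parity-≢ ce jc je)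
    where
    open K₅MinusEdge k
    open CommonNeighbours x≢y ¬xy
    jc = joining cx cy
    jd = joining dx dy
    je = joining ex ey

-- Prime powers

^-monoʳ-∣ : ∀ m {i j} → i ≤ j → m ^ i ∣ m ^ j
^-monoʳ-∣ m {i} {j} i≤j =
  subst (m ^ i ∣_) (trans (sym (^-distribˡ-+-* m i (j ∸ i))) (cong (m ^_) (m+[n∸m]≡n i≤j))) (m∣m*n _)

^-∣-total : ∀ m i j → m ^ i ∣ m ^ j ⊎ m ^ j ∣ m ^ i
^-∣-total m i j with ≤-total i j
... | inj₁ i≤j = inj₁ (^-monoʳ-∣ m i≤j)
... | inj₂ j≤i = inj₂ (^-monoʳ-∣ m j≤i)

prime-divisor : ∀ m → ∃[ p ] (Prime p × p ∣ 2+ m)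
prime-divisor m with factorise (2+ m)
... | record { factors = [] ; isFactorisation = () }
... | record { factors = p ∷ _ ; isFactorisation = n≡Πps ; factorsPrime = p-prime ∷ _ } =
  p , p-prime , subst (p ∣_) (sym n≡Πps) (m∣m*n _)

module _ {p : ℕ} (p-prime : Prime p) where
  private instance
    p≢0 = prime⇒nonZero p-prime
    p-nonTrivial = prime⇒nonTrivial p-prime

  prime∤⇒coprime : ∀ {d} → ¬ p ∣ d → Coprime p d
  prime∤⇒coprime p∤d (i∣p , i∣d) with prime⇒irreducible p-prime i∣p
  ... | inj₁ i≡1 = i≡1
  ... | inj₂ refl = ⊥-elim (p∤d i∣d)

  ∣p^k⇒≡p^i : ∀ k {d} → d ∣ p ^ k → ∃[ i ] (d ≡ p ^ i)
  ∣p^k⇒≡p^i zero    d∣1 = 0 , ∣1⇒≡1 d∣1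
  ∣p^k⇒≡p^i (suc k) {d} d∣pᵏ⁺¹ with p ∣? d
  ... | no p∤d = ∣p^k⇒≡p^i k (coprime-divisor (coprime-sym (prime∤⇒coprime p∤d)) d∣pᵏ⁺¹)
  ... | yes (divides q refl) =
    let i , q≡pⁱ = ∣p^k⇒≡p^i k (*-cancelʳ-∣ {q} p (subst (q * p ∣_) (*-comm p (p ^ k)) d∣pᵏ⁺¹))
    in suc i , trans (cong (_* p) q≡pⁱ) (*-comm (p ^ i) p)

  ∣p^k-total : ∀ {k a b} → a ∣ p ^ k → b ∣ p ^ k → a ∣ b ⊎ b ∣ a
  ∣p^k-total {k} a∣pᵏ b∣pᵏ with ∣p^k⇒≡p^i k a∣pᵏ | ∣p^k⇒≡p^i k b∣pᵏ
  ... | i , refl | j , refl = ^-∣-total p i j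

  coprime-p^k : ∀ k {r} → ¬ p ∣ r → Coprime (p ^ k) r
  coprime-p^k k p∤r (d∣pᵏ , d∣r) with ∣p^k⇒≡p^i k d∣pᵏ
  ... | zero  , d≡1 = d≡1
  ... | suc i , refl = ⊥-elim (p∤r (∣-trans (m∣m*n (p ^ i)) d∣r))

  p-part : ∀ m → .{{NonZero m}} → ∃₂ λ k r → m ≡ p ^ k * r × ¬ p ∣ r
  p-part m = go m (<-wellFounded m)
    where
    go : ∀ m → .{{NonZero m}} → Acc _<_ m → ∃₂ λ k r → m ≡ p ^ k * r × ¬ p ∣ r
    go m (acc smaller) with p ∣? m
    ... | no p∤m = 0 , m , sym (*-identityˡ m) , p∤m
    ... | yes (divides q@(suc _) refl) =
      let k , r , q≡pᵏr , p∤r = go q (smaller (m<m*n q p (nonTrivial⇒n>1 p)))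
      in suc k , r , trans (cong (_* p) q≡pᵏr) (reassoc (p ^ k) r p) , p∤r
      where
      reassoc : ∀ a b c → a * b * c ≡ c * a * b
      reassoc = solve-∀

IsPrimePower : ℕ → Set
IsPrimePower n = ∃[ p ] (Prime p × ∃[ k ] (n ≡ p ^ k))

CoprimeSplit : ℕ → Set
CoprimeSplit n = ∃₂ λ a b → a * b ≡ n × Coprime a b × 2 ≤ a × 2 ≤ b

primePower⊎coprimeSplit : ∀ n → .{{NonZero n}} → IsPrimePower n ⊎ CoprimeSplit n
primePower⊎coprimeSplit 1 = inj₁ (2 , prime[2] , 0 , refl)
primePower⊎coprimeSplit n@(2+ m) with prime-divisor m
... | p , p-prime , p∣n with p-part p-prime n
...   | k     , 0         , _        , p∤0 = ⊥-elim (p∤0 (p ∣0))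
...   | k     , 1         , n≡pᵏ*1   , _   = inj₁ (p , p-prime , k , trans n≡pᵏ*1 (*-identityʳ (p ^ k)))
...   | zero  , r@(2+ _)  , n≡1*r    , p∤r =
  ⊥-elim (p∤r (subst (p ∣_) (trans n≡1*r (*-identityˡ r)) p∣n))
...   | suc k , r@(2+ _)  , n≡pᵏ⁺¹*r , p∤r =
  inj₂ (p ^ suc k , r , sym n≡pᵏ⁺¹*r , coprime-p^k p-prime (suc k) p∤r , 2≤pᵏ⁺¹ , s≤s (s≤s z≤n))
  where
  instance _ = prime⇒nonZero p-prime
  2≤pᵏ⁺¹ : 2 ≤ p ^ suc k
  2≤pᵏ⁺¹ = *-mono-≤ (nonTrivial⇒n>1 p {{prime⇒nonTrivial p-prime}}) (m^n>0 p k)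

-- Complete graphs are line graphs of stars

StarAdj : ∀ {n} → Maybe (Fin n) → Maybe (Fin n) → Set
StarAdj nothing  (just _) = ⊤
StarAdj (just _) nothing  = ⊤
StarAdj _        _        = ⊥

star : ℕ → SimpleGraph
star n = record
  { V      = Maybe (Fin n)
  ; Adj    = StarAdj
  ; sym    = λ { {nothing} {just _} _ → _ ; {just _} {nothing} _ → _ }
  ; irrefl = λ { {nothing} () ; {just _} () }
  }

complete⇒lineGraphOfStar : ∀ {n} {A : Fin n → Fin n → Set} →
  (∀ u v → u ≢ v → A u v) → (∀ u v → A u v → u ≢ v) → LineGraphIso A (star n)
complete⇒lineGraphOfStar complete irreflexive = record
  { ends   = λ x → nothing , just x
  ; isEdge = λ _ → _
  ; onto   = λ { nothing (just y) _ → y , inj₁ (refl , refl)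
               ; (just y) nothing _ → y , inj₂ (refl , refl) }
  ; inj    = λ { x .x (inj₁ (_ , refl)) → refl }
  ; adjIff = λ x y → mk⇔ (λ a → irreflexive x y a , inj₁ (inj₁ refl)) (λ (x≢y , _) → complete x y x≢y)
  }

-- Power graphs of finite groups

module PowerGraph {n : ℕ} (G : FinGroup n) where
  open FinGroup G
  open IsGroup isGroup using (assoc; identityˡ; identityʳ; inverseʳ)

  group : Group 0ℓ 0ℓ
  group = record { isGroup = isGroup }

  open GroupProperties group
    using (∙-cancelˡ; inverseˡ-unique; inverseʳ-unique; ⁻¹-involutive; \\-leftDividesʳ; //-rightDividesʳ)

  instance
    n≢0 : NonZero n
    n≢0 = nonZeroIndex ε

  infixr 8 _^ᴳ_
  _^ᴳ_ : Fin n → ℕ → Fin n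
  _^ᴳ_ = pow G

  ^-+ : ∀ g a b → g ^ᴳ (a + b) ≡ g ^ᴳ a ∙ g ^ᴳ b
  ^-+ g zero    b = sym (identityˡ _)
  ^-+ g (suc a) b = trans (cong (g ∙_) (^-+ g a b)) (sym (assoc _ _ _))

  ^-* : ∀ g a b → g ^ᴳ (b * a) ≡ (g ^ᴳ a) ^ᴳ b
  ^-* g a zero    = refl
  ^-* g a (suc b) = trans (^-+ g a (b * a)) (cong (g ^ᴳ a ∙_) (^-* g a b))

  ε^ : ∀ m → ε ^ᴳ m ≡ ε
  ε^ zero    = refl
  ε^ (suc m) = trans (cong (ε ∙_) (ε^ m)) (identityˡ ε)

  ^-*-ε : ∀ g d k → g ^ᴳ d ≡ ε → g ^ᴳ (k * d) ≡ ε
  ^-*-ε g d k e = trans (^-* g d k) (trans (cong (_^ᴳ k) e) (ε^ k))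

  ^-% : ∀ g d m → .{{_ : NonZero d}} → g ^ᴳ d ≡ ε → g ^ᴳ m ≡ g ^ᴳ (m % d)
  ^-% g d m e = begin
    g ^ᴳ m                           ≡⟨ cong (g ^ᴳ_) (m≡m%n+[m/n]*n m d) ⟩
    g ^ᴳ (m % d + m / d * d)         ≡⟨ ^-+ g (m % d) _ ⟩
    g ^ᴳ (m % d) ∙ g ^ᴳ (m / d * d)  ≡⟨ cong (g ^ᴳ (m % d) ∙_) (^-*-ε g d (m / d) e) ⟩
    g ^ᴳ (m % d) ∙ ε                 ≡⟨ identityʳ _ ⟩
    g ^ᴳ (m % d)                     ∎
    where open ≡-Reasoning

  ^-cancel : ∀ g i j → g ^ᴳ i ≡ g ^ᴳ (i + j) → g ^ᴳ j ≡ ε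
  ^-cancel g i j e = sym (∙-cancelˡ _ _ _ (trans (identityʳ _) (trans e (^-+ g i j))))

  ^-≡⇒period : ∀ g {s t} → s < t → g ^ᴳ s ≡ g ^ᴳ t → ∃[ d ] (g ^ᴳ suc d ≡ ε × s + suc d ≡ t)
  ^-≡⇒period g {s} {t} s<t gˢ≡gᵗ =
    d , ^-cancel g s (suc d) (trans gˢ≡gᵗ (cong (g ^ᴳ_) (sym s+d≡t))) , s+d≡t
    where
    d = t ∸ suc s
    s+d≡t : s + suc d ≡ t
    s+d≡t = trans (+-suc s d) (m+[n∸m]≡n s<t)

  finite-order : ∀ g → ∃[ d ] (g ^ᴳ suc d ≡ ε × suc d ≤ n)
  finite-order g with pigeonhole (n<1+n n) (λ (i : Fin (suc n)) → g ^ᴳ toℕ i)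
  ... | i , j , i<j , gⁱ≡gʲ =
    let d , gᵈ⁺¹≡ε , i+d≡j = ^-≡⇒period g i<j gⁱ≡gʲ
    in d , gᵈ⁺¹≡ε , ≤-trans (m≤n+m (suc d) (toℕ i)) (≤-trans (≤-reflexive i+d≡j) (toℕ≤pred[n] j))

  infix 4 _≼_ _≼?_ _≺_
  _≼_ : Fin n → Fin n → Set
  h ≼ x = ∃[ m ] (x ^ᴳ m ≡ h)

  ≼-refl : ∀ {x} → x ≼ x
  ≼-refl {x} = 1 , identityʳ x

  ≼-reflexive : ∀ {x y} → x ≡ y → x ≼ y
  ≼-reflexive refl = ≼-refl

  ≼-trans : ∀ {x y z} → x ≼ y → y ≼ z → x ≼ z
  ≼-trans {z = z} (a , yᵃ≡x) (b , zᵇ≡y) = a * b , trans (^-* z b a) (trans (cong (_^ᴳ a) zᵇ≡y) yᵃ≡x)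

  ε-≼ : ∀ {x} → ε ≼ x
  ε-≼ = 0 , refl

  ≼-ε : ∀ {x} → x ≼ ε → x ≡ ε
  ≼-ε (m , εᵐ≡x) = trans (sym εᵐ≡x) (ε^ m)

  ⋠⇒≢ : ∀ {x y} → ¬ x ≼ y → x ≢ y
  ⋠⇒≢ x⋠y x≡y = x⋠y (≼-reflexive x≡y)

  ⋠⇒≢ε : ∀ {x y} → ¬ x ≼ y → x ≢ ε
  ⋠⇒≢ε x⋠y refl = x⋠y ε-≼

  ⁻¹-≼ : ∀ x → x ⁻¹ ≼ x
  ⁻¹-≼ x = let d , xᵈ⁺¹≡ε , _ = finite-order x in d , inverseʳ-unique x (x ^ᴳ d) xᵈ⁺¹≡ε

  ∙-≼ : ∀ {x y a} → x ≼ a → y ≼ a → x ∙ y ≼ a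
  ∙-≼ {a = a} (i , aⁱ≡x) (j , aʲ≡y) = i + j , trans (^-+ a i j) (cong₂ _∙_ aⁱ≡x aʲ≡y)

  ≼⇒^-below : ∀ {h x d} → x ^ᴳ suc d ≡ ε → h ≼ x → ∃[ i ] (i < suc d × x ^ᴳ i ≡ h)
  ≼⇒^-below {x = x} {d} xᵈ⁺¹≡ε (m , xᵐ≡h) =
    m % suc d , m%n<n m (suc d) , trans (sym (^-% x (suc d) m xᵈ⁺¹≡ε)) xᵐ≡h

  ≼⇒^-bounded : ∀ {h x} → h ≼ x → ∃[ i ] (x ^ᴳ toℕ i ≡ h)
  ≼⇒^-bounded {x = x} h≼x =
    let d , xᵈ⁺¹≡ε , d<n = finite-order x
        i , i<d , xⁱ≡h = ≼⇒^-below xᵈ⁺¹≡ε h≼x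
        i<n = <-≤-trans i<d d<n
    in fromℕ< i<n , trans (cong (x ^ᴳ_) (toℕ-fromℕ< i<n)) xⁱ≡h

  _≼?_ : ∀ h x → Dec (h ≼ x)
  h ≼? x = map′ (λ (i , e) → toℕ i , e) ≼⇒^-bounded (any? (λ i → x ^ᴳ toℕ i ≟ᶠ h))

  ≼⇒^suc : ∀ {h x} → h ≼ x → ∃[ m ] (x ^ᴳ suc m ≡ h)
  ≼⇒^suc {h} {x} (m , xᵐ≡h) =
    let d , xᵈ⁺¹≡ε , _ = finite-order x
    in d + m , trans (^-+ x (suc d) m) (trans (cong₂ _∙_ xᵈ⁺¹≡ε xᵐ≡h) (identityˡ h))

  comparable⇒powerAdj : ∀ {x y} → x ≢ y → y ≼ x ⊎ x ≼ y → PowerAdj G x y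
  comparable⇒powerAdj x≢y (inj₁ y≼x) = x≢y , inj₁ (≼⇒^suc y≼x)
  comparable⇒powerAdj x≢y (inj₂ x≼y) = x≢y , inj₂ (≼⇒^suc x≼y)

  ε-powerAdj : ∀ {x} → x ≢ ε → PowerAdj G ε x
  ε-powerAdj x≢ε = comparable⇒powerAdj (x≢ε ∘ sym) (inj₂ ε-≼)

  incomparable⇒¬powerAdj : ∀ {x y} → ¬ y ≼ x → ¬ x ≼ y → ¬ PowerAdj G x y
  incomparable⇒¬powerAdj y⋠x _   (_ , inj₁ (m , xᵐ⁺¹≡y)) = y⋠x (suc m , xᵐ⁺¹≡y)
  incomparable⇒¬powerAdj _   x⋠y (_ , inj₂ (m , yᵐ⁺¹≡x)) = x⋠y (suc m , yᵐ⁺¹≡x)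

  dominating-powerAdj : ∀ {u v w} → (∀ h → h ≼ u) → ¬ w ≼ v → PowerAdj G u v
  dominating-powerAdj {u} {v} {w} u-dominates w⋠v =
    comparable⇒powerAdj (λ u≡v → w⋠v (subst (w ≼_) u≡v (u-dominates w))) (inj₁ (u-dominates v))

  ∣⇒^-≼ : ∀ x {d t} → d ∣ t → x ^ᴳ t ≼ x ^ᴳ d
  ∣⇒^-≼ x {d} (divides q refl) = q , sym (^-* x d q)

  ^-gcd-≼ : ∀ x {N} s → x ^ᴳ N ≡ ε → x ^ᴳ gcd s N ≼ x ^ᴳ s
  ^-gcd-≼ x {N} s xᴺ≡ε with Bézout.identity (gcd-GCD s N)
  ... | Bézout.+- a b d+bN≡as = a , (begin
    (x ^ᴳ s) ^ᴳ a          ≡⟨ sym (^-* x s a) ⟩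
    x ^ᴳ (a * s)           ≡⟨ cong (x ^ᴳ_) (sym d+bN≡as) ⟩
    x ^ᴳ (d + b * N)       ≡⟨ ^-+ x d (b * N) ⟩
    x ^ᴳ d ∙ x ^ᴳ (b * N)  ≡⟨ cong (x ^ᴳ d ∙_) (^-*-ε x N b xᴺ≡ε) ⟩
    x ^ᴳ d ∙ ε             ≡⟨ identityʳ _ ⟩
    x ^ᴳ d                 ∎)
    where
    open ≡-Reasoning
    d = gcd s N
  ... | Bézout.-+ a b d+as≡bN =
    subst (_≼ x ^ᴳ s) (sym xᵈ≡[xᵃˢ]⁻¹) (≼-trans (⁻¹-≼ (x ^ᴳ (a * s))) (∣⇒^-≼ x (n∣m*n a)))
    where
    d = gcd s N
    xᵈ≡[xᵃˢ]⁻¹ : x ^ᴳ d ≡ (x ^ᴳ (a * s)) ⁻¹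
    xᵈ≡[xᵃˢ]⁻¹ = inverseˡ-unique _ _ (begin
      x ^ᴳ d ∙ x ^ᴳ (a * s)  ≡⟨ sym (^-+ x d (a * s)) ⟩
      x ^ᴳ (d + a * s)       ≡⟨ cong (x ^ᴳ_) d+as≡bN ⟩
      x ^ᴳ (b * N)           ≡⟨ ^-*-ε x N b xᴺ≡ε ⟩
      ε                      ∎)
      where open ≡-Reasoning

  _≺_ : Fin n → Fin n → Set
  x ≺ y = x ≼ y × ¬ y ≼ x

  ≺-isStrictPartialOrder : IsStrictPartialOrder _≡_ _≺_
  ≺-isStrictPartialOrder = record
    { isEquivalence = isEquivalence
    ; irrefl        = λ { refl (x≼x , x⋠x) → x⋠x x≼x }
    ; trans         = λ (x≼y , y⋠x) (y≼z , z⋠y) → ≼-trans x≼y y≼z , λ z≼x → z⋠y (≼-trans z≼x x≼y)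
    ; <-resp-≈      = (λ { refl x≺y → x≺y }) , (λ { refl x≺y → x≺y })
    }

  Maximal : Fin n → Set
  Maximal y = ∀ c → y ≼ c → c ≼ y

  maximal-above : ∀ x → ∃[ y ] (x ≼ y × Maximal y)
  maximal-above x = go (spo-noetherian ≺-isStrictPartialOrder x)
    where
    go : ∀ {x} → Acc (flip _≺_) x → ∃[ y ] (x ≼ y × Maximal y)
    go {x} (acc larger) with any? (λ c → x ≼? c ×-dec ¬? (c ≼? x))
    ... | yes (c , x≺c) = let y , c≼y , y-max = go (larger x≺c) in y , ≼-trans (proj₁ x≺c) c≼y , y-max
    ... | no ∄c         = x , ≼-refl , λ c x≼c → decidable-stable (c ≼? x) (λ c⋠x → ∄c (c , x≼c , c⋠x))

  maximal-claw : ∀ {a b c} → Maximal a → Maximal b → Maximal c → ¬ b ≼ a → a ∙ b ≼ c →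
                 Claw (PowerAdj G)
  maximal-claw {a} {b} {c} a-max b-max c-max b⋠a ab≼c = record
    { centre = ε ; a = a ; b = b ; c = c
    ; adj-a = ε-powerAdj (⋠⇒≢ε a⋠b)
    ; adj-b = ε-powerAdj (⋠⇒≢ε b⋠a)
    ; adj-c = ε-powerAdj (⋠⇒≢ε c⋠a)
    ; a≢b = ⋠⇒≢ a⋠b
    ; b≢c = ⋠⇒≢ b⋠c
    ; a≢c = ⋠⇒≢ a⋠c
    ; ¬ab = incomparable⇒¬powerAdj b⋠a a⋠b
    ; ¬bc = incomparable⇒¬powerAdj c⋠b b⋠c
    ; ¬ac = incomparable⇒¬powerAdj c⋠a a⋠c
    }
    where
    a⋠b : ¬ a ≼ b
    a⋠b a≼b = b⋠a (a-max b a≼b)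
    ab⋠a : ¬ a ∙ b ≼ a
    ab⋠a ab≼a = b⋠a (subst (_≼ a) (\\-leftDividesʳ a b) (∙-≼ (⁻¹-≼ a) ab≼a))
    ab⋠b : ¬ a ∙ b ≼ b
    ab⋠b ab≼b = a⋠b (subst (_≼ b) (//-rightDividesʳ b a) (∙-≼ ab≼b (⁻¹-≼ b)))
    c⋠a : ¬ c ≼ a
    c⋠a c≼a = ab⋠a (≼-trans ab≼c c≼a)
    c⋠b : ¬ c ≼ b
    c⋠b c≼b = ab⋠b (≼-trans ab≼c c≼b)
    a⋠c : ¬ a ≼ c
    a⋠c a≼c = c⋠a (a-max c a≼c)
    b⋠c : ¬ b ≼ c
    b⋠c b≼c = c⋠b (b-max c b≼c)

  claw-free⇒cyclic : ¬ Claw (PowerAdj G) → IsCyclic G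
  claw-free⇒cyclic no-claw with maximal-above ε
  ... | a , _ , a-max with all? (_≼? a)
  ...   | yes all≼a = a , all≼a
  ...   | no ¬all≼a =
    let h , h⋠a = ¬∀⟶∃¬ n _ (_≼? a) ¬all≼a
        b , h≼b , b-max = maximal-above h
        c , ab≼c , c-max = maximal-above (a ∙ b)
    in ⊥-elim (no-claw (maximal-claw a-max b-max c-max (h⋠a ∘ ≼-trans h≼b) ab≼c))

  module Generator {g : Fin n} (generates : ∀ h → h ≼ g) where

    generates⁻¹ : ∀ h → h ≼ g ⁻¹
    generates⁻¹ h = ≼-trans (generates h) (subst (_≼ g ⁻¹) (⁻¹-involutive g) (⁻¹-≼ (g ⁻¹)))

    generator-order : ∀ d → g ^ᴳ suc d ≡ ε → n ≤ suc d
    generator-order d gᵈ⁺¹≡ε = injective⇒≤ index-injective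
      where
      index : Fin n → Fin (suc d)
      index h = fromℕ< (proj₁ (proj₂ (≼⇒^-below gᵈ⁺¹≡ε (generates h))))
      ^-index : ∀ h → g ^ᴳ toℕ (index h) ≡ h
      ^-index h = let _ , i<d , gⁱ≡h = ≼⇒^-below gᵈ⁺¹≡ε (generates h)
                  in trans (cong (g ^ᴳ_) (toℕ-fromℕ< i<d)) gⁱ≡h
      index-injective : ∀ {h k} → index h ≡ index k → h ≡ k
      index-injective {h} {k} e = trans (sym (^-index h)) (trans (cong ((g ^ᴳ_) ∘ toℕ) e) (^-index k))

    ^n≡ε : g ^ᴳ n ≡ ε
    ^n≡ε = let d , gᵈ⁺¹≡ε , d<n = finite-order g
           in subst (λ k → g ^ᴳ k ≡ ε) (≤-antisym d<n (generator-order d gᵈ⁺¹≡ε)) gᵈ⁺¹≡ε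

    ^-distinct : ∀ {s t} → s < t → t < n → g ^ᴳ s ≢ g ^ᴳ t
    ^-distinct {s} {t} s<t t<n gˢ≡gᵗ =
      let d , gᵈ⁺¹≡ε , s+d≡t = ^-≡⇒period g s<t gˢ≡gᵗ
      in <⇒≱ t<n (≤-trans (generator-order d gᵈ⁺¹≡ε) (≤-trans (m≤n+m (suc d) s) (≤-reflexive s+d≡t)))

    ^-injective : ∀ {s t} → s < n → t < n → g ^ᴳ s ≡ g ^ᴳ t → s ≡ t
    ^-injective {s} {t} s<n t<n gˢ≡gᵗ with <-cmp s t
    ... | tri< s<t _ _ = ⊥-elim (^-distinct s<t t<n gˢ≡gᵗ)
    ... | tri≈ _ s≡t _ = s≡t
    ... | tri> _ _ t<s = ⊥-elim (^-distinct t<s s<n (sym gˢ≡gᵗ))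

    ^-≡⇒%≡ : ∀ {s t} → g ^ᴳ s ≡ g ^ᴳ t → s % n ≡ t % n
    ^-≡⇒%≡ {s} {t} gˢ≡gᵗ = ^-injective (m%n<n s n) (m%n<n t n)
      (trans (sym (^-% g n s ^n≡ε)) (trans gˢ≡gᵗ (^-% g n t ^n≡ε)))

    ^-≼-^⇒∣ : ∀ {a b} .{{_ : NonZero b}} → b ∣ n → g ^ᴳ a ≼ g ^ᴳ b → b ∣ a
    ^-≼-^⇒∣ {a} {b} b∣n (c , gᵇᶜ≡gᵃ) = m%n≡0⇒n∣m a b (begin
      a % b              ≡⟨ sym (m∣n⇒o%n%m≡o%m b n a b∣n) ⟩
      a % n % b          ≡⟨ cong (_% b) (^-≡⇒%≡ (trans (^-* g b c) gᵇᶜ≡gᵃ)) ⟨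
      c * b % n % b      ≡⟨ m∣n⇒o%n%m≡o%m b n (c * b) b∣n ⟩
      c * b % b          ≡⟨ m*n%n≡0 c b ⟩
      0                  ∎)
      where open ≡-Reasoning

    coprime⇒^⋠^ : ∀ {a b} → b ∣ n → Coprime a b → 2 ≤ b → ¬ g ^ᴳ a ≼ g ^ᴳ b
    coprime⇒^⋠^ {a} {b} b∣n coprime 2≤b gᵃ≼gᵇ = <⇒≢ 2≤b (sym (coprime (b∣a , ∣-refl)))
      where
      instance _ = >-nonZero (<-trans z<s 2≤b)
      b∣a = ^-≼-^⇒∣ b∣n gᵃ≼gᵇ

    generator≢⁻¹ : 2 < n → g ≢ g ⁻¹
    generator≢⁻¹ 2<n g≡g⁻¹ = case ^-injective 2<n (>-nonZero⁻¹ n) g²≡ε of λ ()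
      where
      g²≡ε : g ^ᴳ 2 ≡ g ^ᴳ 0
      g²≡ε = begin
        g ∙ (g ∙ ε)  ≡⟨ cong (g ∙_) (identityʳ g) ⟩
        g ∙ g        ≡⟨ cong (g ∙_) g≡g⁻¹ ⟩
        g ∙ g ⁻¹     ≡⟨ inverseʳ g ⟩
        ε            ∎
        where open ≡-Reasoning

    coprimeSplit⇒K₅MinusEdge : CoprimeSplit n → K₅MinusEdge (PowerAdj G)
    coprimeSplit⇒K₅MinusEdge (a , b , ab≡n , coprime , 2≤a , 2≤b) = record
      { x = g ^ᴳ b ; y = g ^ᴳ a ; c = g ; d = g ⁻¹ ; e = ε
      ; x≢y = ⋠⇒≢ x⋠y
      ; ¬xy = incomparable⇒¬powerAdj y⋠x x⋠y
      ; cx  = dominating-powerAdj generates y⋠x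
      ; cy  = dominating-powerAdj generates x⋠y
      ; dx  = dominating-powerAdj generates⁻¹ y⋠x
      ; dy  = dominating-powerAdj generates⁻¹ x⋠y
      ; ex  = ε-powerAdj (⋠⇒≢ε x⋠y)
      ; ey  = ε-powerAdj (⋠⇒≢ε y⋠x)
      ; cd  = comparable⇒powerAdj (generator≢⁻¹ 2<n) (inj₁ (⁻¹-≼ g))
      ; de  = dominating-powerAdj generates⁻¹ x⋠ε
      ; ce  = dominating-powerAdj generates x⋠ε
      }
      where
      2<n : 2 < n
      2<n = subst (2 <_) ab≡n (≤-trans (n≤1+n 3) (*-mono-≤ 2≤a 2≤b))
      x⋠y : ¬ g ^ᴳ b ≼ g ^ᴳ a
      x⋠y = coprime⇒^⋠^ (divides b (trans (sym ab≡n) (*-comm a b))) (coprime-sym coprime) 2≤a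
      y⋠x : ¬ g ^ᴳ a ≼ g ^ᴳ b
      y⋠x = coprime⇒^⋠^ (divides a (sym ab≡n)) coprime 2≤b
      x⋠ε : ¬ g ^ᴳ b ≼ ε
      x⋠ε = ⋠⇒≢ε x⋠y ∘ ≼-ε

    primePower⇒complete : IsPrimePower n → ∀ u v → u ≢ v → PowerAdj G u v
    primePower⇒complete (p , p-prime , k , n≡pᵏ) u v u≢v with generates u | generates v
    ... | s , refl | t , refl = comparable⇒powerAdj u≢v
      (Sum.map (gcd-∣-≼ s t) (gcd-∣-≼ t s) (∣p^k-total p-prime {k} (gcd-∣p^k s) (gcd-∣p^k t)))
      where
      gcd-∣p^k : ∀ s → gcd s n ∣ p ^ k
      gcd-∣p^k s = subst (gcd s n ∣_) n≡pᵏ (gcd[m,n]∣n s n)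
      gcd-∣-≼ : ∀ s t → gcd s n ∣ gcd t n → g ^ᴳ t ≼ g ^ᴳ s
      gcd-∣-≼ s t gₛ∣gₜ =
        ≼-trans (∣⇒^-≼ g (gcd[m,n]∣m t n)) (≼-trans (∣⇒^-≼ g gₛ∣gₜ) (^-gcd-≼ g s ^n≡ε))

  lineGraph⇒cyclicPGroup : IsLineGraph (PowerAdj G) → IsCyclicPGroup G
  lineGraph⇒cyclicPGroup (_ , L) with claw-free⇒cyclic (LineGraph.claw-free L)
  ... | cyclic@(_ , generates) with primePower⊎coprimeSplit n
  ...   | inj₁ primePower = cyclic , primePower
  ...   | inj₂ coprimeSplit =
    ⊥-elim (LineGraph.K₅MinusEdge-free L (Generator.coprimeSplit⇒K₅MinusEdge generates coprimeSplit))

  cyclicPGroup⇒lineGraph : IsCyclicPGroup G → IsLineGraph (PowerAdj G)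
  cyclicPGroup⇒lineGraph ((_ , generates) , primePower) =
    star n , complete⇒lineGraphOfStar (Generator.primePower⇒complete generates primePower)
                                      (λ _ _ → proj₁)

mainTheorem1 : (n : ℕ) (G : FinGroup n) → IsNilpotent G →
    (IsLineGraph (PowerAdj G) ⇔ IsCyclicPGroup G)
mainTheorem1 n G _ = mk⇔ lineGraph⇒cyclicPGroup cyclicPGroup⇒lineGraph
  where open PowerGraph G
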